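{- Let $d$ be a dyadic rational with $0\le d<1$ and let $m$ be an integer. If $m>0$, then $\{d\mid\,\}:m=\{\{d\mid\,\}:(m-1)\mid\,\}$. If $m<0$, then $\{d\mid\,\}:m=\{d\mid \{d\mid\,\}:(m+1)\}$.
   Context: Short partizan games under normal play. For game forms $G,H$ the ordinal sum is $G:H=\{G^{\mathcal L},G:H^{\mathcal L}\,|\,G^{\mathcal R},G:H^{\mathcal R}\}$, using the options of the literal form of the base $G$ and of the subordinate $H$. $\{x\mid\,\}$ denotes the game with single Left option $x$ and no Right option (used literally as the base). Integers are game forms in canonical form. Equalities are equalities of game values. -}

module Defs where

open import Data.Nat using (ℕ; zero; suc; _+_)
open import Data.Nat.DivMod using (_/_; _%_)
open import Data.Fin using (Fin; splitAt)
open import Data.Sum using ([_,_]′)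
open import Data.Product using (_×_)
open import Data.Integer using (ℤ; +_; -[1+_])
open import Relation.Nullary using (¬_)

data Game : Set where
  mk : (nL : ℕ) → (Fin nL → Game) → (nR : ℕ) → (Fin nR → Game) → Game

noOpt : {A : Set} → Fin 0 → A
noOpt ()

∅G : Game
∅G = mk 0 noOpt 0 noOpt

⟨_∣⟩ : Game → Game
⟨ x ∣⟩ = mk 1 (λ _ → x) 0 noOpt

⟨∣_⟩ : Game → Game
⟨∣ y ⟩ = mk 0 noOpt 1 (λ _ → y)

⟨_∣_⟩ : Game → Game → Game
⟨ x ∣ y ⟩ = mk 1 (λ _ → x) 1 (λ _ → y)

_≤G_ : Game → Game → Set
mk gl GL gr GR ≤G mk hl HL hr HR =
  ((i : Fin gl) → ¬ (mk hl HL hr HR ≤G GL i)) ×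
  ((j : Fin hr) → ¬ (HR j ≤G mk gl GL gr GR))

_≈G_ : Game → Game → Set
G ≈G H = (G ≤G H) × (H ≤G G)

-- Ordinal sum G : H = { G^L , G:H^L | G^R , G:H^R } (literal forms).
_∶_ : Game → Game → Game
mk gl GL gr GR ∶ mk hl HL hr HR =
  mk (gl + hl) (λ i → [ GL , (λ j → mk gl GL gr GR ∶ HL j) ]′ (splitAt gl i))
     (gr + hr) (λ i → [ GR , (λ j → mk gl GL gr GR ∶ HR j) ]′ (splitAt gr i))

intG : ℤ → Game
intG (+ zero) = ∅G
intG (+ suc n) = ⟨ intG (+ n) ∣⟩
intG -[1+ zero ] = ⟨∣ ∅G ⟩
intG -[1+ suc n ] = ⟨∣ intG -[1+ n ] ⟩

-- Canonical form of the dyadic rational m / 2^k, for 0 ≤ m ≤ 2^k.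
-- Level 0: 0 and 1.  Level k+1: if m is even, it is (m/2)/2^k;
-- if m is odd it is { (m-1)/2^(k+1) | (m+1)/2^(k+1) }, i.e.
-- { ⌊m/2⌋/2^k | (⌊m/2⌋+1)/2^k }.
dyadicG : ℕ → ℕ → Game
dyadicG zero zero = ∅G
dyadicG zero (suc _) = ⟨ ∅G ∣⟩
dyadicG (suc k) m with m % 2
... | zero = dyadicG k (m / 2)
... | suc _ = ⟨ dyadicG k (m / 2) ∣ dyadicG k (suc (m / 2)) ⟩

{-# OPTIONS --safe #-}
module Submission where

open import Defs
open import Data.Nat using (ℕ; _^_)
open import Data.Product using (_×_)
open import Data.Integer using (ℤ; +_; 0ℤ; 1ℤ; _+_; _-_; _<_)
open import Data.Nat renaming (_<_ to _<ℕ_) using ()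

open import Data.Nat using (zero; suc; _*_; s≤s)
open import Data.Nat.Properties using (*-comm; *-cancelʳ-<; <⇒≤)
open import Data.Nat.DivMod using (_/_; _%_; m*n%n≡0; m*n/n≡m; [m+kn]%n≡m%n; +-distrib-/-∣ʳ)
open import Data.Nat.Divisibility using (divides-refl)
open import Data.Integer using (-[1+_]; +<+)
open import Data.Fin using (Fin)
import Data.Fin as Fin
open import Data.Product using (_,_)
open import Relation.Nullary using (¬_)
open import Relation.Binary.PropositionalEquality using (_≡_; refl; sym; trans; cong; subst; subst₂)
open Relation.Binary.PropositionalEquality.≡-Reasoning

-- Since {d |} has no Right option, {d |} : n for n > 0 is literally
-- {d , {d |} : (n - 1) |}, and the Left option d is dominated: d ≤ {d |} : (n - 1)
-- as soon as every Left option of d lies below d, which holds for canonical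
-- dyadics by induction on the level (the odd case uses d(p+1) ≰ d(p), clear
-- since of two consecutive dyadics of positive level one is an option of the
-- other). For n < 0 both sides have the same options, merely indexed differently.

≤G-leftOption : ∀ {nl L nr R} Y (i : Fin nl) → mk nl L nr R ≤G Y → ¬ (Y ≤G L i)
≤G-leftOption (mk _ _ _ _) i (noLeft , _) = noLeft i

≤G-rightOption : ∀ {nl L nr R} X (j : Fin nr) → X ≤G mk nl L nr R → ¬ (R j ≤G X)
≤G-rightOption (mk _ _ _ _) j (_ , noRight) = noRight j

≤G-refl : ∀ G → G ≤G G
≤G-refl (mk nl L nr R) =
  (λ i h → ≤G-leftOption (L i) i h (≤G-refl (L i))) ,
  (λ j h → ≤G-rightOption (R j) j h (≤G-refl (R j)))

≰G-leftOption : ∀ {nl L nr R} D (i : Fin nl) → L i ≡ D → ¬ (mk nl L nr R ≤G D)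
≰G-leftOption D i refl h = ≤G-leftOption D i h (≤G-refl D)

≰G-rightOption : ∀ {nl L nr R} D (j : Fin nr) → R j ≡ D → ¬ (D ≤G mk nl L nr R)
≰G-rightOption D j refl h = ≤G-rightOption D j h (≤G-refl D)

mk-≤G : ∀ {nl nr} {L L′ : Fin nl → Game} {R R′ : Fin nr → Game} →
        (∀ i → L i ≡ L′ i) → (∀ j → R j ≡ R′ j) → mk nl L nr R ≤G mk nl L′ nr R′
mk-≤G {L = L} {R′ = R′} L≡L′ R≡R′ =
  (λ i → ≰G-leftOption (L i) i (sym (L≡L′ i))) ,
  (λ j → ≰G-rightOption (R′ j) j (R≡R′ j))

mk-≈G : ∀ {nl nr} {L L′ : Fin nl → Game} {R R′ : Fin nr → Game} →
        (∀ i → L i ≡ L′ i) → (∀ j → R j ≡ R′ j) → mk nl L nr R ≈G mk nl L′ nr R′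
mk-≈G L≡L′ R≡R′ = mk-≤G L≡L′ R≡R′ , mk-≤G (λ i → sym (L≡L′ i)) (λ j → sym (R≡R′ j))

LeftOptionsBelow : Game → Set
LeftOptionsBelow (mk nl L nr R) = ∀ i → L i ≤G mk nl L nr R

≤G-of-leftOption : ∀ {D hl HL hr HR} (i : Fin hl) → HL i ≡ D → LeftOptionsBelow D →
                   (∀ j → ¬ (HR j ≤G D)) → D ≤G mk hl HL hr HR
≤G-of-leftOption {mk _ DL _ _} i HLi≡D below noRightBelow =
  (λ i′ h → subst (λ Z → ¬ (DL i′ ≤G Z)) HLi≡D (≤G-leftOption (DL i′) i h) (below i′)) ,
  noRightBelow

ordinalSum-⟨_∣⟩ : ∀ Y D → D ≤G (⟨ D ∣⟩ ∶ Y) → (⟨ D ∣⟩ ∶ ⟨ Y ∣⟩) ≈G ⟨ ⟨ D ∣⟩ ∶ Y ∣⟩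
ordinalSum-⟨ Y ∣⟩ D D≤sum =
  ((λ { Fin.zero h → ≤G-leftOption D Fin.zero h D≤sum
      ; (Fin.suc Fin.zero) → ≰G-leftOption (⟨ D ∣⟩ ∶ Y) Fin.zero refl }) , λ ()) ,
  ((λ { Fin.zero → ≰G-leftOption (⟨ D ∣⟩ ∶ Y) (Fin.suc Fin.zero) refl }) , λ ())

ordinalSum-⟨∣_⟩ : ∀ Y D → (⟨ D ∣⟩ ∶ ⟨∣ Y ⟩) ≈G ⟨ D ∣ ⟨ D ∣⟩ ∶ Y ⟩
ordinalSum-⟨∣ Y ⟩ D = mk-≈G (λ { Fin.zero → refl }) (λ { Fin.zero → refl })

≤G-⟨_∣⟩∶nonneg : ∀ D → LeftOptionsBelow D → ∀ j → D ≤G (⟨ D ∣⟩ ∶ intG (+ j))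
-- The split on j only serves to unfold the ordinal sum.
≤G-⟨ D ∣⟩∶nonneg below zero = ≤G-of-leftOption Fin.zero refl below λ ()
≤G-⟨ D ∣⟩∶nonneg below (suc j) = ≤G-of-leftOption Fin.zero refl below λ ()

data Halving : ℕ → Set where
  even : ∀ p → Halving (p * 2)
  odd : ∀ p → Halving (suc (p * 2))

halving : ∀ m → Halving m
halving zero = even 0
halving (suc m) with halving m
... | even p = odd p
... | odd p = even (suc p)

dyadicG-suc-of-even : ∀ k m → m % 2 ≡ 0 → dyadicG (suc k) m ≡ dyadicG k (m / 2)
dyadicG-suc-of-even k m m%2≡0 with m % 2 | m%2≡0
... | _ | refl = refl

dyadicG-suc-of-odd : ∀ k m → m % 2 ≡ 1 →
                     dyadicG (suc k) m ≡ ⟨ dyadicG k (m / 2) ∣ dyadicG k (suc (m / 2)) ⟩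
dyadicG-suc-of-odd k m m%2≡1 with m % 2 | m%2≡1
... | _ | refl = refl

dyadicG-even : ∀ k p → dyadicG (suc k) (p * 2) ≡ dyadicG k p
dyadicG-even k p = begin
  dyadicG (suc k) (p * 2)  ≡⟨ dyadicG-suc-of-even k (p * 2) (m*n%n≡0 p 2) ⟩
  dyadicG k (p * 2 / 2)    ≡⟨ cong (dyadicG k) (m*n/n≡m p 2) ⟩
  dyadicG k p              ∎

dyadicG-odd : ∀ k p → dyadicG (suc k) (suc (p * 2)) ≡ ⟨ dyadicG k p ∣ dyadicG k (suc p) ⟩
dyadicG-odd k p = begin
  dyadicG (suc k) (suc (p * 2))
    ≡⟨ dyadicG-suc-of-odd k (suc (p * 2)) ([m+kn]%n≡m%n 1 p 2) ⟩
  ⟨ dyadicG k (suc (p * 2) / 2) ∣ dyadicG k (suc (suc (p * 2) / 2)) ⟩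
    ≡⟨ cong (λ q → ⟨ dyadicG k q ∣ dyadicG k (suc q) ⟩) odd/2 ⟩
  ⟨ dyadicG k p ∣ dyadicG k (suc p) ⟩ ∎
  where
  odd/2 : suc (p * 2) / 2 ≡ p
  odd/2 = trans (+-distrib-/-∣ʳ 1 {p * 2} {2} (divides-refl p)) (m*n/n≡m p 2)

halve-< : ∀ {p} k → p * 2 <ℕ 2 ^ suc k → p <ℕ 2 ^ k
halve-< {p} k p*2<2^[1+k] = *-cancelʳ-< 2 p (2 ^ k) (subst (p * 2 <ℕ_) (*-comm 2 (2 ^ k)) p*2<2^[1+k])

dyadicG-next-≰ : ∀ k q → q <ℕ 2 ^ k → ¬ (dyadicG k (suc q) ≤G dyadicG k q)
dyadicG-next-≰ zero zero _ = ≰G-leftOption ∅G Fin.zero refl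
dyadicG-next-≰ zero (suc q) (s≤s ())
dyadicG-next-≰ (suc k) q _ with halving q
... | even p = subst₂ (λ U V → ¬ (U ≤G V)) (sym (dyadicG-odd k p)) (sym (dyadicG-even k p))
                 (≰G-leftOption (dyadicG k p) Fin.zero refl)
... | odd p = subst₂ (λ U V → ¬ (U ≤G V)) (sym (dyadicG-even k (suc p))) (sym (dyadicG-odd k p))
                (≰G-rightOption (dyadicG k (suc p)) Fin.zero refl)

dyadicG-leftOptionsBelow : ∀ k m → m <ℕ 2 ^ k → LeftOptionsBelow (dyadicG k m)
dyadicG-leftOptionsBelow zero zero _ = λ ()
dyadicG-leftOptionsBelow zero (suc m) (s≤s ())
dyadicG-leftOptionsBelow (suc k) m m<2^[1+k] with halving m
... | even p = subst LeftOptionsBelow (sym (dyadicG-even k p))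
                 (dyadicG-leftOptionsBelow k p (halve-< k m<2^[1+k]))
... | odd p = subst LeftOptionsBelow (sym (dyadicG-odd k p))
                λ { Fin.zero → ≤G-of-leftOption Fin.zero refl (dyadicG-leftOptionsBelow k p p<2^k)
                                 λ { Fin.zero → dyadicG-next-≰ k p p<2^k } }
  where
  p<2^k : p <ℕ 2 ^ k
  p<2^k = halve-< k (<⇒≤ m<2^[1+k])

lemma2p8 : (k m : ℕ) → m <ℕ 2 ^ k → (n : ℤ) →
    ((0ℤ < n → (⟨ dyadicG k m ∣⟩ ∶ intG n) ≈G ⟨ ⟨ dyadicG k m ∣⟩ ∶ intG (n - 1ℤ) ∣⟩) ×
     (n < 0ℤ → (⟨ dyadicG k m ∣⟩ ∶ intG n) ≈G ⟨ dyadicG k m ∣ ⟨ dyadicG k m ∣⟩ ∶ intG (n + 1ℤ) ⟩))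
lemma2p8 k m m<2^k (+ zero) = (λ { (+<+ ()) }) , λ { (+<+ ()) }
lemma2p8 k m m<2^k (+ suc j) =
  (λ _ → ordinalSum-⟨ intG (+ j) ∣⟩ d (≤G-⟨ d ∣⟩∶nonneg (dyadicG-leftOptionsBelow k m m<2^k) j)) ,
  λ { (+<+ ()) }
  where d = dyadicG k m
lemma2p8 k m m<2^k -[1+ zero ] = (λ ()) , λ _ → ordinalSum-⟨∣ ∅G ⟩ (dyadicG k m)
lemma2p8 k m m<2^k -[1+ suc j ] = (λ ()) , λ _ → ordinalSum-⟨∣ intG -[1+ j ] ⟩ (dyadicG k m)
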